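{- Let $0\le r\le n$ and $w,w'\in S(n,r)$. If $w'\sqsubseteq w$, then $w^c\sqsubseteq (w')^c$.
   Context: $A(n,r)$ is an alphabet of $n+1$ formal symbols $\tilde 1,\dots,\tilde r,\ 0^\S,\ \bar 1,\dots,\overline{n-r}$, totally ordered by $\overline{n-r}\prec\cdots\prec\bar1\prec 0^\S\prec\tilde1\prec\cdots\prec\tilde r$. $S(n,r)$ is the set of strings $w=i_1\cdots i_r\,|\,j_1\cdots j_{n-r}$ with $i_k\in\{\tilde1,\dots,\tilde r,0^\S\}$, $j_k\in\{0^\S,\bar1,\dots,\overline{n-r}\}$ such that for some $0\le p\le r$, $1\le q\le n-r+1$: $i_1\succ\cdots\succ i_p\succ 0^\S=i_{p+1}=\cdots=i_r$ and $j_1=\cdots=j_{q-1}=0^\S\succ j_q\succ\cdots\succ j_{n-r}$, ordered componentwise by $\preceq$ (order written $\sqsubseteq$). A string is determined by its set of non-$0^\S$ symbols, and each subset of $A(n,r)\setminus\{0^\S\}$ arises from exactly one string. For $w\in S(n,r)$, $w^c$ is the string whose set of non-$0^\S$ symbols is the complement in $A(n,r)\setminus\{0^\S\}$ of that of $w$. -}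

module Defs where

open import Data.Nat using (ℕ; zero; suc; _+_; _∸_; _≤_; _<_)
open import Data.Fin using (Fin; toℕ)
open import Data.Vec using (Vec; lookup)
open import Data.Product using (Σ; _×_; ∃-syntax)
open import Data.Sum using (_⊎_)
open import Relation.Binary.PropositionalEquality using (_≡_)
open import Relation.Nullary using (¬_)
open import Data.Unit using (⊤)
open import Data.Empty using (⊥)

-- The alphabet A(n,r), with m = n - r barred symbols.
-- tilde k  represents  \tilde{k+1}   (k : Fin r)
-- zeroS    represents  0^§
-- bar k    represents  \overline{k+1} (k : Fin m)
data Sym (r m : ℕ) : Set where
  tilde : Fin r → Sym r m
  zeroS : Sym r m
  bar   : Fin m → Sym r m

-- Position in the total order
--   \overline{m} ≺ ... ≺ \bar1 ≺ 0^§ ≺ \tilde1 ≺ ... ≺ \tilde r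
rank : ∀ {r m} → Sym r m → ℕ
rank {m = m} (tilde k) = m + suc (toℕ k)
rank {m = m} zeroS     = m
rank {m = m} (bar k)   = m ∸ suc (toℕ k)

_≼_ : ∀ {r m} → Sym r m → Sym r m → Set
s ≼ t = rank s ≤ rank t

_≺_ : ∀ {r m} → Sym r m → Sym r m → Set
s ≺ t = rank s < rank t

LeftSym : ∀ {r m} → Sym r m → Set
LeftSym (tilde _) = ⊤
LeftSym zeroS     = ⊤
LeftSym (bar _)   = ⊥

RightSym : ∀ {r m} → Sym r m → Set
RightSym (tilde _) = ⊥
RightSym zeroS     = ⊤
RightSym (bar _)   = ⊤

-- Shape of the left block i_1 ... i_r (0-indexed positions k, i.e. i_{k+1}):
-- for some 0 ≤ p ≤ r,  i_1 ≻ ... ≻ i_p ≻ 0^§ = i_{p+1} = ... = i_r.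
LeftShape : ∀ {r m} → Vec (Sym r m) r → Set
LeftShape {r} is =
  ∃[ p ] (p ≤ r)
    × (∀ (k : Fin r) → toℕ k < p → zeroS ≺ lookup is k)
    × (∀ (k : Fin r) → p ≤ toℕ k → lookup is k ≡ zeroS)
    × (∀ (k l : Fin r) → toℕ k < toℕ l → toℕ l < p → lookup is l ≺ lookup is k)

-- Shape of the right block j_1 ... j_m (0-indexed positions k, i.e. j_{k+1}):
-- for some 1 ≤ q ≤ m+1,  j_1 = ... = j_{q-1} = 0^§ ≻ j_q ≻ ... ≻ j_m.
RightShape : ∀ {r m} → Vec (Sym r m) m → Set
RightShape {m = m} js =
  ∃[ q ] (1 ≤ q) × (q ≤ suc m)
    × (∀ (k : Fin m) → suc (toℕ k) < q → lookup js k ≡ zeroS)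
    × (∀ (k : Fin m) → q ≤ suc (toℕ k) → lookup js k ≺ zeroS)
    × (∀ (k l : Fin m) → q ≤ suc (toℕ k) → toℕ k < toℕ l → lookup js l ≺ lookup js k)

record Str (n r : ℕ) : Set where
  field
    left       : Vec (Sym r (n ∸ r)) r
    right      : Vec (Sym r (n ∸ r)) (n ∸ r)
    leftSyms   : ∀ k → LeftSym (lookup left k)
    rightSyms  : ∀ k → RightSym (lookup right k)
    leftShape  : LeftShape left
    rightShape : RightShape right
open Str public

_⊑_ : ∀ {n r} → Str n r → Str n r → Set
w ⊑ w' = (∀ k → lookup (left w) k ≼ lookup (left w') k)
       × (∀ k → lookup (right w) k ≼ lookup (right w') k)

_∈ₛ_ : ∀ {n r} → Sym r (n ∸ r) → Str n r → Set
s ∈ₛ w = ¬ (s ≡ zeroS) × ((∃[ k ] lookup (left w) k ≡ s) ⊎ (∃[ k ] lookup (right w) k ≡ s))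

IsComplement : ∀ {n r} → Str n r → Str n r → Set
IsComplement {n} {r} w v =
  ∀ (s : Sym r (n ∸ r)) → ¬ (s ≡ zeroS) → (s ∈ₛ v → ¬ (s ∈ₛ w)) × (¬ (s ∈ₛ w) → s ∈ₛ v)

-- Compare strings through their rank counts: for a block with ranks f and a
-- threshold a, let c_f(a) be the number of positions whose rank is at least a.
-- For a weakly decreasing block, f k ≥ a iff k < c_f(a), so one block is
-- pointwise below another iff its counts are. Every non-0^§ symbol of a block's
-- range lies in exactly one of w and w^c, hence c_w(a) + c_{w^c}(a) + a does not
-- depend on a, and is therefore the same for w and w'. So w' ⊑ w gives
-- c_{w'} ≤ c_w, hence c_{w^c} ≤ c_{w'^c}, hence w^c ⊑ w'^c.
module Submission where

open import Defs
open import Data.Nat using (ℕ; zero; suc; _+_; _∸_; _≤_; _<_; _≤′_; ≤′-refl; ≤′-step; z≤n; s≤s; z<s; _≤?_; _<?_; _≟_)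
open import Data.Nat.Properties
open import Data.Fin using (Fin; zero; suc; toℕ; fromℕ<)
open import Data.Fin.Properties using (toℕ-injective; toℕ<n; toℕ-fromℕ<; any?) renaming (suc-injective to Fin-suc-injective)
open import Data.Vec using (Vec; lookup)
open import Data.Product using (∃-syntax; _,_; proj₁; proj₂)
open import Data.Sum using (inj₁; inj₂)
open import Function using (_∘_; _⇔_; mk⇔; module Equivalence)
open import Relation.Nullary using (¬_; yes; no; contradiction)
open import Relation.Binary using (tri<; tri≈; tri>)
open import Relation.Binary.PropositionalEquality
open import Algebra.Properties.CommutativeSemigroup +-commutativeSemigroup using (interchange)

countAtLeast : ∀ {N} → (Fin N → ℕ) → ℕ → ℕ
countAtLeast {zero}  f a = 0
countAtLeast {suc N} f a with a ≤? f zero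
... | yes _ = suc (countAtLeast (f ∘ suc) a)
... | no  _ = countAtLeast (f ∘ suc) a

countEqual : ∀ {N} → (Fin N → ℕ) → ℕ → ℕ
countEqual {zero}  f a = 0
countEqual {suc N} f a with f zero ≟ a
... | yes _ = suc (countEqual (f ∘ suc) a)
... | no  _ = countEqual (f ∘ suc) a

Decreasing : ∀ {N} → (Fin N → ℕ) → Set
Decreasing f = ∀ k l → toℕ k ≤ toℕ l → f l ≤ f k

Attains : ∀ {N} → (Fin N → ℕ) → ℕ → Set
Attains f a = ∃[ k ] f k ≡ a

UniqueAt : ∀ {N} → (Fin N → ℕ) → ℕ → Set
UniqueAt f a = ∀ k l → f k ≡ a → f l ≡ a → k ≡ l

countAtLeast-suc : ∀ {N} (f : Fin N → ℕ) a →
  countAtLeast f a ≡ countEqual f a + countAtLeast f (suc a)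
countAtLeast-suc {zero} f a = refl
countAtLeast-suc {suc N} f a with a ≤? f zero | f zero ≟ a | suc a ≤? f zero
... | yes _   | yes f0≡a | yes a<f0 = contradiction (sym f0≡a) (<⇒≢ a<f0)
... | yes _   | yes _    | no  _    = cong suc (countAtLeast-suc (f ∘ suc) a)
... | yes _   | no  _    | yes _    =
  trans (cong suc (countAtLeast-suc (f ∘ suc) a)) (sym (+-suc _ _))
... | yes a≤f0 | no f0≢a | no a≮f0  = contradiction (≤∧≢⇒< a≤f0 (f0≢a ∘ sym)) a≮f0
... | no  a≰f0 | yes f0≡a | _       = contradiction (≤-reflexive (sym f0≡a)) a≰f0
... | no  a≰f0 | no _    | yes a<f0 = contradiction (<⇒≤ a<f0) a≰f0
... | no  _   | no  _    | no  _    = countAtLeast-suc (f ∘ suc) a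

countAtLeast-none : ∀ {N} (f : Fin N → ℕ) a → (∀ k → f k < a) → countAtLeast f a ≡ 0
countAtLeast-none {zero} f a f<a = refl
countAtLeast-none {suc N} f a f<a with a ≤? f zero
... | yes a≤f0 = contradiction a≤f0 (<⇒≱ (f<a zero))
... | no  _    = countAtLeast-none (f ∘ suc) a (f<a ∘ suc)

countAtLeast-all : ∀ {N} (f : Fin N → ℕ) a → (∀ k → a ≤ f k) → countAtLeast f a ≡ N
countAtLeast-all {zero} f a a≤f = refl
countAtLeast-all {suc N} f a a≤f with a ≤? f zero
... | yes _    = cong suc (countAtLeast-all (f ∘ suc) a (a≤f ∘ suc))
... | no  a≰f0 = contradiction (a≤f zero) a≰f0

countAtLeast-mono : ∀ {N} (g f : Fin N → ℕ) a → (∀ k → g k ≤ f k) →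
  countAtLeast g a ≤ countAtLeast f a
countAtLeast-mono {zero} g f a g≤f = z≤n
countAtLeast-mono {suc N} g f a g≤f with a ≤? g zero | a ≤? f zero
... | yes _    | yes _    = s≤s (countAtLeast-mono (g ∘ suc) (f ∘ suc) a (g≤f ∘ suc))
... | yes a≤g0 | no  a≰f0 = contradiction (≤-trans a≤g0 (g≤f zero)) a≰f0
... | no  _    | yes _    = m≤n⇒m≤1+n (countAtLeast-mono (g ∘ suc) (f ∘ suc) a (g≤f ∘ suc))
... | no  _    | no  _    = countAtLeast-mono (g ∘ suc) (f ∘ suc) a (g≤f ∘ suc)

Decreasing-suc : ∀ {N} (f : Fin (suc N) → ℕ) → Decreasing f → Decreasing (f ∘ suc)
Decreasing-suc f dec k l k≤l = dec (suc k) (suc l) (s≤s k≤l)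

≤⇒<-countAtLeast : ∀ {N} (f : Fin N → ℕ) a → Decreasing f →
  ∀ k → a ≤ f k → toℕ k < countAtLeast f a
≤⇒<-countAtLeast {suc N} f a dec k a≤fk with a ≤? f zero
≤⇒<-countAtLeast {suc N} f a dec zero    a≤fk | yes _ = s≤s z≤n
≤⇒<-countAtLeast {suc N} f a dec (suc k) a≤fk | yes _ =
  s≤s (≤⇒<-countAtLeast (f ∘ suc) a (Decreasing-suc f dec) k a≤fk)
... | no a≰f0 = contradiction (≤-trans a≤fk (dec zero k z≤n)) a≰f0

<-countAtLeast⇒≤ : ∀ {N} (f : Fin N → ℕ) a → Decreasing f →
  ∀ k → toℕ k < countAtLeast f a → a ≤ f k
<-countAtLeast⇒≤ {suc N} f a dec k k<c with a ≤? f zero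
<-countAtLeast⇒≤ {suc N} f a dec zero    k<c       | yes a≤f0 = a≤f0
<-countAtLeast⇒≤ {suc N} f a dec (suc k) (s≤s k<c) | yes _ =
  <-countAtLeast⇒≤ (f ∘ suc) a (Decreasing-suc f dec) k k<c
... | no a≰f0 = contradiction k<c (<⇒≱ (subst (_< suc (toℕ k)) (sym none) z<s))
  where
  none : countAtLeast (f ∘ suc) a ≡ 0
  none = countAtLeast-none (f ∘ suc) a
           (λ j → ≤-<-trans (dec zero (suc j) z≤n) (≰⇒> a≰f0))

strictlyDecreasingOn⇒UniqueAt : ∀ {N} (f : Fin N → ℕ) {a} (S : Fin N → Set) →
  (∀ k → f k ≡ a → S k) → (∀ k l → toℕ k < toℕ l → S k → S l → f l < f k) →
  UniqueAt f a
strictlyDecreasingOn⇒UniqueAt f S in-S strict k l ek el with <-cmp (toℕ k) (toℕ l)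
... | tri< k<l _ _ =
  contradiction (trans el (sym ek)) (<⇒≢ (strict k l k<l (in-S k ek) (in-S l el)))
... | tri≈ _ k≡l _ = toℕ-injective k≡l
... | tri> _ _ l<k =
  contradiction (trans ek (sym el)) (<⇒≢ (strict l k l<k (in-S l el) (in-S k ek)))

countEqual-none : ∀ {N} (f : Fin N → ℕ) a → (∀ k → f k ≢ a) → countEqual f a ≡ 0
countEqual-none {zero} f a f≢a = refl
countEqual-none {suc N} f a f≢a with f zero ≟ a
... | yes f0≡a = contradiction f0≡a (f≢a zero)
... | no  _    = countEqual-none (f ∘ suc) a (f≢a ∘ suc)

countEqual-unique : ∀ {N} (f : Fin N → ℕ) a → UniqueAt f a → Attains f a →
  countEqual f a ≡ 1
countEqual-unique {suc N} f a uniq (k , fk≡a) with f zero ≟ a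
... | yes f0≡a = cong suc (countEqual-none (f ∘ suc) a
                   (λ j fj≡a → 0≢1+n (cong toℕ (uniq zero (suc j) f0≡a fj≡a))))
countEqual-unique {suc N} f a uniq (zero  , fk≡a) | no f0≢a = contradiction fk≡a f0≢a
countEqual-unique {suc N} f a uniq (suc k , fk≡a) | no _ =
  countEqual-unique (f ∘ suc) a
    (λ i j fi≡a fj≡a → Fin-suc-injective (uniq (suc i) (suc j) fi≡a fj≡a))
    (k , fk≡a)

countEqual-exclusive : ∀ {N} (f g : Fin N → ℕ) a → UniqueAt f a → UniqueAt g a →
  (Attains f a → ¬ Attains g a) → (¬ Attains f a → Attains g a) →
  countEqual f a + countEqual g a ≡ 1
countEqual-exclusive f g a uniq-f uniq-g not-both one with any? (λ k → f k ≟ a)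
... | yes in-f = cong₂ _+_ (countEqual-unique f a uniq-f in-f)
                           (countEqual-none g a (λ k gk≡a → not-both in-f (k , gk≡a)))
... | no ∉f    = cong₂ _+_ (countEqual-none f a (λ k fk≡a → ∉f (k , fk≡a)))
                           (countEqual-unique g a uniq-g (one ∉f))

balance : ∀ {N} → (Fin N → ℕ) → (Fin N → ℕ) → ℕ → ℕ
balance f g a = countAtLeast f a + countAtLeast g a + a

balance-suc : ∀ {N} (f g : Fin N → ℕ) a → countEqual f a + countEqual g a ≡ 1 →
  balance f g a ≡ balance f g (suc a)
balance-suc f g a exactlyOne = begin
  countAtLeast f a + countAtLeast g a + a
    ≡⟨ cong₂ (λ u v → u + v + a) (countAtLeast-suc f a) (countAtLeast-suc g a) ⟩
  (countEqual f a + x) + (countEqual g a + y) + a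
    ≡⟨ cong (_+ a) (interchange (countEqual f a) x (countEqual g a) y) ⟩
  (countEqual f a + countEqual g a) + (x + y) + a
    ≡⟨ cong (λ e → e + (x + y) + a) exactlyOne ⟩
  suc (x + y + a)
    ≡⟨ sym (+-suc (x + y) a) ⟩
  x + y + suc a ∎
  where
  open ≡-Reasoning
  x = countAtLeast f (suc a)
  y = countAtLeast g (suc a)

balance-constant : ∀ {N} (f g : Fin N → ℕ) {a b} → a ≤′ b →
  (∀ c → a ≤ c → c < b → countEqual f c + countEqual g c ≡ 1) →
  balance f g a ≡ balance f g b
balance-constant f g ≤′-refl             exactlyOne = refl
balance-constant f g {b = suc b} (≤′-step a≤′b) exactlyOne =
  trans (balance-constant f g a≤′b (λ c a≤c c<b → exactlyOne c a≤c (m≤n⇒m≤1+n c<b)))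
        (balance-suc f g b (exactlyOne b (≤′⇒≤ a≤′b) ≤-refl))

balance-comparison : ∀ {N} (f g f′ g′ : Fin N → ℕ) → Decreasing g → Decreasing g′ →
  (∀ k → f′ k ≤ f k) → ∀ k → balance f g (g k) ≡ balance f′ g′ (g k) → g k ≤ g′ k
balance-comparison f g f′ g′ dec-g dec-g′ f′≤f k balances =
  <-countAtLeast⇒≤ g′ a dec-g′ k (<-≤-trans (≤⇒<-countAtLeast g a dec-g k ≤-refl) counts)
  where
  a = g k
  counts : countAtLeast g a ≤ countAtLeast g′ a
  counts = +-cancelˡ-≤ (countAtLeast f a) _ _ (begin
    countAtLeast f a + countAtLeast g a   ≡⟨ +-cancelʳ-≡ a _ _ balances ⟩
    countAtLeast f′ a + countAtLeast g′ a ≤⟨ +-monoˡ-≤ _ (countAtLeast-mono f′ f a f′≤f) ⟩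
    countAtLeast f a + countAtLeast g′ a  ∎)
    where open ≤-Reasoning

module _ {r m : ℕ} where

  rank-injective : (s t : Sym r m) → rank s ≡ rank t → s ≡ t
  rank-injective (tilde i) (tilde j) eq =
    cong tilde (toℕ-injective (suc-injective (+-cancelˡ-≡ m _ _ eq)))
  rank-injective (tilde i) zeroS eq = contradiction (sym eq) (<⇒≢ (m<m+n m z<s))
  rank-injective (tilde i) (bar j) eq =
    contradiction (≤-trans (≤-reflexive eq) (m∸n≤m m (suc (toℕ j)))) (<⇒≱ (m<m+n m z<s))
  rank-injective zeroS (tilde j) eq = contradiction eq (<⇒≢ (m<m+n m z<s))
  rank-injective zeroS zeroS eq = refl
  rank-injective zeroS (bar j) eq = contradiction eq (≢-sym (<⇒≢ (∸-monoʳ-< z<s (toℕ<n j))))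
  rank-injective (bar i) zeroS eq = contradiction eq (<⇒≢ (∸-monoʳ-< z<s (toℕ<n i)))
  rank-injective (bar i) (tilde j) eq =
    contradiction (≤-trans (≤-reflexive (sym eq)) (m∸n≤m m (suc (toℕ i)))) (<⇒≱ (m<m+n m z<s))
  rank-injective (bar i) (bar j) eq =
    cong bar (toℕ-injective (suc-injective (∸-cancelˡ-≡ (toℕ<n i) (toℕ<n j) eq)))

  rank≢rank-zeroS : (s : Sym r m) → s ≢ zeroS → rank s ≢ m
  rank≢rank-zeroS s s≢0 eq = s≢0 (rank-injective s zeroS eq)

  rank-LeftSym-≤ : (s : Sym r m) → LeftSym s → rank s ≤ m + r
  rank-LeftSym-≤ (tilde i) _ = +-monoʳ-≤ m (toℕ<n i)
  rank-LeftSym-≤ zeroS     _ = m≤m+n m r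

  tilde-of-rank : ∀ {c} → m < c → c ≤ m + r → ∃[ i ] rank (tilde {r} {m} i) ≡ c
  tilde-of-rank {c} m<c c≤m+r = fromℕ< j<r , trans (cong (λ t → m + suc t) (toℕ-fromℕ< j<r)) m+1+j≡c
    where
    j = c ∸ suc m
    m+1+j≡c : m + suc j ≡ c
    m+1+j≡c = trans (+-suc m j) (m+[n∸m]≡n m<c)
    j<r : j < r
    j<r = +-cancelˡ-< m j r (≤-trans (≤-reflexive (m+[n∸m]≡n m<c)) c≤m+r)

  bar-of-rank : ∀ {c} → c < m → ∃[ i ] rank (bar {r} {m} i) ≡ c
  bar-of-rank {c} c<m = fromℕ< i<m , (begin
    m ∸ suc (toℕ (fromℕ< i<m)) ≡⟨ cong (λ t → m ∸ suc t) (toℕ-fromℕ< i<m) ⟩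
    m ∸ suc (m ∸ suc c)        ≡⟨ cong (m ∸_) (sym (+-∸-assoc 1 c<m)) ⟩
    m ∸ (m ∸ c)                ≡⟨ m∸[m∸n]≡n (<⇒≤ c<m) ⟩
    c                          ∎)
    where
    open ≡-Reasoning
    i<m : m ∸ suc c < m
    i<m = ∸-monoʳ-< z<s c<m

  leftShape-≥ : (is : Vec (Sym r m) r) → LeftShape is → ∀ k → m ≤ rank (lookup is k)
  leftShape-≥ is (p , _ , pos , zs , _) k with toℕ k <? p
  ... | yes k<p = <⇒≤ (pos k k<p)
  ... | no  k≮p = ≤-reflexive (cong rank (sym (zs k (≮⇒≥ k≮p))))

  leftShape-decreasing : (is : Vec (Sym r m) r) → LeftShape is → Decreasing (rank ∘ lookup is)
  leftShape-decreasing is shape@(p , _ , _ , zs , dec) k l k≤l with toℕ l <? p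
  ... | no l≮p = ≤-trans (≤-reflexive (cong rank (zs l (≮⇒≥ l≮p)))) (leftShape-≥ is shape k)
  ... | yes l<p with m≤n⇒m<n∨m≡n k≤l
  ...   | inj₁ k<l = <⇒≤ (dec k l k<l l<p)
  ...   | inj₂ k≡l = ≤-reflexive (cong (rank ∘ lookup is) (toℕ-injective (sym k≡l)))

  leftShape-unique : (is : Vec (Sym r m) r) → LeftShape is → ∀ a → a ≢ m →
    UniqueAt (rank ∘ lookup is) a
  leftShape-unique is (p , _ , _ , zs , dec) a a≢m =
    strictlyDecreasingOn⇒UniqueAt (rank ∘ lookup is) (λ j → toℕ j < p) below-p
      (λ k l k<l _ l<p → dec k l k<l l<p)
    where
    below-p : ∀ j → rank (lookup is j) ≡ a → toℕ j < p
    below-p j ej with toℕ j <? p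
    ... | yes j<p = j<p
    ... | no  j≮p = contradiction (trans (sym ej) (cong rank (zs j (≮⇒≥ j≮p)))) a≢m

  rightShape-≤ : (js : Vec (Sym r m) m) → RightShape js → ∀ k → rank (lookup js k) ≤ m
  rightShape-≤ js (q , _ , _ , zs , neg , _) k with q ≤? suc (toℕ k)
  ... | yes q≤k = <⇒≤ (neg k q≤k)
  ... | no  q≰k = ≤-reflexive (cong rank (zs k (≰⇒> q≰k)))

  rightShape-decreasing : (js : Vec (Sym r m) m) → RightShape js → Decreasing (rank ∘ lookup js)
  rightShape-decreasing js shape@(q , _ , _ , zs , _ , dec) k l k≤l with q ≤? suc (toℕ k)
  ... | no q≰k = ≤-trans (rightShape-≤ js shape l) (≤-reflexive (cong rank (sym (zs k (≰⇒> q≰k)))))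
  ... | yes q≤k with m≤n⇒m<n∨m≡n k≤l
  ...   | inj₁ k<l = <⇒≤ (dec k l q≤k k<l)
  ...   | inj₂ k≡l = ≤-reflexive (cong (rank ∘ lookup js) (toℕ-injective (sym k≡l)))

  rightShape-unique : (js : Vec (Sym r m) m) → RightShape js → ∀ a → a ≢ m →
    UniqueAt (rank ∘ lookup js) a
  rightShape-unique js (q , _ , _ , zs , _ , dec) a a≢m =
    strictlyDecreasingOn⇒UniqueAt (rank ∘ lookup js) (λ j → q ≤ suc (toℕ j)) from-q
      (λ k l k<l q≤k _ → dec k l q≤k k<l)
    where
    from-q : ∀ j → rank (lookup js j) ≡ a → q ≤ suc (toℕ j)
    from-q j ej with q ≤? suc (toℕ j)
    ... | yes q≤j = q≤j
    ... | no  q≰j = contradiction (trans (sym ej) (cong rank (zs j (≰⇒> q≰j)))) a≢m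

  LeftSym∧RightSym⇒zeroS : (s : Sym r m) → LeftSym s → RightSym s → s ≡ zeroS
  LeftSym∧RightSym⇒zeroS zeroS _ _ = refl

leftRanks : ∀ {n r} → Str n r → Fin r → ℕ
leftRanks w = rank ∘ lookup (left w)

rightRanks : ∀ {n r} → Str n r → Fin (n ∸ r) → ℕ
rightRanks w = rank ∘ lookup (right w)

module _ {n r : ℕ} where

  ∈ₛ⇔attains-left : (w : Str n r) (s : Sym r (n ∸ r)) → LeftSym s → s ≢ zeroS →
    s ∈ₛ w ⇔ Attains (leftRanks w) (rank s)
  ∈ₛ⇔attains-left w s left-s s≢0 = mk⇔ to from
    where
    to : s ∈ₛ w → Attains (leftRanks w) (rank s)
    to (_ , inj₁ (k , e)) = k , cong rank e
    to (_ , inj₂ (k , e)) =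
      contradiction (LeftSym∧RightSym⇒zeroS s left-s (subst RightSym e (rightSyms w k))) s≢0
    from : Attains (leftRanks w) (rank s) → s ∈ₛ w
    from (k , e) = s≢0 , inj₁ (k , rank-injective _ s e)

  ∈ₛ⇔attains-right : (w : Str n r) (s : Sym r (n ∸ r)) → RightSym s → s ≢ zeroS →
    s ∈ₛ w ⇔ Attains (rightRanks w) (rank s)
  ∈ₛ⇔attains-right w s right-s s≢0 = mk⇔ to from
    where
    to : s ∈ₛ w → Attains (rightRanks w) (rank s)
    to (_ , inj₂ (k , e)) = k , cong rank e
    to (_ , inj₁ (k , e)) =
      contradiction (LeftSym∧RightSym⇒zeroS s (subst LeftSym e (leftSyms w k)) right-s) s≢0
    from : Attains (rightRanks w) (rank s) → s ∈ₛ w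
    from (k , e) = s≢0 , inj₂ (k , rank-injective _ s e)

  complement-countEqual : ∀ {N} (w wc : Str n r) → IsComplement w wc →
    (ranks : Str n r → Fin N → ℕ) (s : Sym r (n ∸ r)) → s ≢ zeroS →
    (∀ v → s ∈ₛ v ⇔ Attains (ranks v) (rank s)) → (∀ v → UniqueAt (ranks v) (rank s)) →
    countEqual (ranks w) (rank s) + countEqual (ranks wc) (rank s) ≡ 1
  complement-countEqual w wc complement ranks s s≢0 occurs unique =
    countEqual-exclusive (ranks w) (ranks wc) (rank s) (unique w) (unique wc)
      (λ in-w in-wc → proj₁ (complement s s≢0) (from (occurs wc) in-wc) (from (occurs w) in-w))
      (λ ∉w → to (occurs wc) (proj₂ (complement s s≢0) (∉w ∘ to (occurs w))))
    where open Equivalence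

  left-balance : (w wc : Str n r) → IsComplement w wc → ∀ {c} → n ∸ r < c →
    c ≤ suc (n ∸ r + r) → balance (leftRanks w) (leftRanks wc) c ≡ suc (n ∸ r + r)
  left-balance w wc complement {c} m<c c≤top =
    trans (balance-constant (leftRanks w) (leftRanks wc) (≤⇒≤′ c≤top) exactlyOne) top
    where
    exactlyOne : ∀ c′ → c ≤ c′ → c′ < suc (n ∸ r + r) →
      countEqual (leftRanks w) c′ + countEqual (leftRanks wc) c′ ≡ 1
    exactlyOne c′ c≤c′ c′<top with tilde-of-rank (<-≤-trans m<c c≤c′) (≤-pred c′<top)
    ... | i , refl = complement-countEqual w wc complement leftRanks (tilde i) (λ ())
      (λ v → ∈ₛ⇔attains-left v (tilde i) _ (λ ()))
      (λ v → leftShape-unique (left v) (leftShape v) _ (rank≢rank-zeroS (tilde i) (λ ())))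
    below-top : ∀ v k → leftRanks v k < suc (n ∸ r + r)
    below-top v k = s≤s (rank-LeftSym-≤ _ (leftSyms v k))
    top : balance (leftRanks w) (leftRanks wc) (suc (n ∸ r + r)) ≡ suc (n ∸ r + r)
    top rewrite countAtLeast-none (leftRanks w) _ (below-top w)
              | countAtLeast-none (leftRanks wc) _ (below-top wc) = refl

  right-balance : (w wc : Str n r) → IsComplement w wc → ∀ {c} → c ≤ n ∸ r →
    balance (rightRanks w) (rightRanks wc) c ≡ n ∸ r + (n ∸ r)
  right-balance w wc complement {c} c≤m =
    trans (sym (balance-constant (rightRanks w) (rightRanks wc) (≤⇒≤′ (z≤n {c})) exactlyOne)) bottom
    where
    exactlyOne : ∀ c′ → 0 ≤ c′ → c′ < c →
      countEqual (rightRanks w) c′ + countEqual (rightRanks wc) c′ ≡ 1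
    exactlyOne c′ _ c′<c with bar-of-rank {r} (<-≤-trans c′<c c≤m)
    ... | i , refl = complement-countEqual w wc complement rightRanks (bar i) (λ ())
      (λ v → ∈ₛ⇔attains-right v (bar i) _ (λ ()))
      (λ v → rightShape-unique (right v) (rightShape v) _ (rank≢rank-zeroS {r} (bar i) (λ ())))
    bottom : balance (rightRanks w) (rightRanks wc) 0 ≡ n ∸ r + (n ∸ r)
    bottom rewrite countAtLeast-all (rightRanks w) 0 (λ _ → z≤n)
                 | countAtLeast-all (rightRanks wc) 0 (λ _ → z≤n) = +-identityʳ _

mainTheorem9 : (n r : ℕ) → r ≤ n → (w w' wc w'c : Str n r)
    → IsComplement w wc → IsComplement w' w'c
    → w' ⊑ w → wc ⊑ w'c
mainTheorem9 n r _ w w' wc w'c complement complement' (left≤ , right≤) =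
  leftComparison , rightComparison
  where
  leftComparison : ∀ k → leftRanks wc k ≤ leftRanks w'c k
  leftComparison k with n ∸ r <? leftRanks wc k
  ... | no  m≮c = ≤-trans (≮⇒≥ m≮c) (leftShape-≥ (left w'c) (leftShape w'c) k)
  ... | yes m<c =
    balance-comparison (leftRanks w) (leftRanks wc) (leftRanks w') (leftRanks w'c)
      (leftShape-decreasing (left wc) (leftShape wc))
      (leftShape-decreasing (left w'c) (leftShape w'c)) left≤ k
      (trans (left-balance w wc complement m<c c≤top) (sym (left-balance w' w'c complement' m<c c≤top)))
    where c≤top = m≤n⇒m≤1+n (rank-LeftSym-≤ _ (leftSyms wc k))
  rightComparison : ∀ k → rightRanks wc k ≤ rightRanks w'c k
  rightComparison k =
    balance-comparison (rightRanks w) (rightRanks wc) (rightRanks w') (rightRanks w'c)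
      (rightShape-decreasing (right wc) (rightShape wc))
      (rightShape-decreasing (right w'c) (rightShape w'c)) right≤ k
      (trans (right-balance w wc complement c≤m) (sym (right-balance w' w'c complement' c≤m)))
    where c≤m = rightShape-≤ (right wc) (rightShape wc) k
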